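{- Let $n$ be an odd positive integer, and suppose that $n-1$ queens are placed on $\mathbb{Z}_n^2$ with no two in conflict. Then one more queen can be placed on $\mathbb{Z}_n^2$ so that the resulting $n$ queens have no two in conflict.
   Context: Queens on the toroidal board $\mathbb{Z}_n^2$ occupy distinct fields; two queens at $(x,y)$ and $(x',y')$ are in conflict iff $x=x'$, or $y=y'$, or $x+y=x'+y'$, or $x-y=x'-y'$ in $\mathbb{Z}_n$. -}

module Defs where

open import Data.Nat using (ℕ; suc; _+_; _∸_; NonZero)
open import Data.Nat.DivMod using (_%_)
open import Data.Fin using (Fin; toℕ)
open import Data.Product using (_×_; _,_)
open import Data.Sum using (_⊎_)
open import Relation.Binary.PropositionalEquality using (_≡_)
open import Relation.Nullary using (¬_)

Field : ℕ → Set
Field n = Fin n × Fin n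

-- Sum and difference of coordinates as elements of ℤ_n, represented by
-- natural numbers in [0,n): x + y mod n and x - y ≡ x + (n - y) mod n.
sumMod : (n : ℕ) .{{_ : NonZero n}} → Fin n → Fin n → ℕ
sumMod n x y = (toℕ x + toℕ y) % n

diffMod : (n : ℕ) .{{_ : NonZero n}} → Fin n → Fin n → ℕ
diffMod n x y = (toℕ x + (n ∸ toℕ y)) % n

Conflict : (n : ℕ) .{{_ : NonZero n}} → Field n → Field n → Set
Conflict n (x , y) (x' , y') =
  (x ≡ x') ⊎ (y ≡ y') ⊎ (sumMod n x y ≡ sumMod n x' y') ⊎ (diffMod n x y ≡ diffMod n x' y')

NonAttacking : (n : ℕ) .{{_ : NonZero n}} → {k : ℕ} → (Fin k → Field n) → Set
NonAttacking n {k} q = ∀ (i j : Fin k) → ¬ i ≡ j → (¬ q i ≡ q j) × ¬ Conflict n (q i) (q j)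

-- Each of the four line families (columns x, rows y, diagonals x + y, antidiagonals x − y) meets
-- the n − 1 queens in n − 1 distinct values, so exactly one value of ℤ_n is missing from each:
-- call them r, c, s, d. As Σ_{v ∈ ℤ_n} v = n(n − 1)/2 ≡ 0 for odd n, a missing value is minus
-- the sum of the occupied ones. Summing x + y and x − y over the queens gives s ≡ r + c and
-- d ≡ r − c, so the field (r, c) lies on no occupied line.
module Submission where

open import Defs
open import Data.Nat using (ℕ; zero; suc; _+_; _*_; _∸_; _≤_; _<_; NonZero)
open import Data.Nat.Properties
  using (+-0-commutativeMonoid; +-commutativeSemigroup; +-identityʳ; +-assoc; m∸n+n≡m; m+[n∸m]≡n;
         <⇒≤; 1+n≰n; *-cancelˡ-≡; +-cancelʳ-≡)
open import Data.Nat.DivMod using (_%_; _mod_; %-distribˡ-+; m%n%n≡m%n; n%n≡0; m%n<n; m<n⇒m%n≡m; m*n%n≡0)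
open import Data.Nat.Tactic.RingSolver using (solve-∀)
open import Data.Fin using (Fin; zero; suc; toℕ; punchOut; _≟_)
open import Data.Fin.Properties
  using (any?; all?; ¬∀⟶∃¬; punchOut-injective; injective⇒≤; toℕ<n; toℕ-fromℕ<; toℕ-injective)
open import Data.Fin.Permutation using (permutation)
open import Data.Vec.Functional using (_∷_)
open import Data.Product using (∃; _,_; proj₁; proj₂)
open import Data.Sum using (inj₁; inj₂)
open import Function using (_∘_)
open import Function.Definitions using (Injective)
open import Relation.Nullary using (¬_; yes; no; ¬?; contradiction)
open import Relation.Nullary.Decidable using (decidable-stable)
open import Relation.Binary.Bundles using (Setoid)
open import Relation.Binary.Structures using (IsEquivalence)
open import Relation.Binary.PropositionalEquality
open import Algebra.Properties.CommutativeSemigroup +-commutativeSemigroup using (interchange; x∙yz≈y∙xz)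
open import Algebra.Properties.CommutativeMonoid.Sum +-0-commutativeMonoid
  using (sum; sum-permute; ∑-distrib-+; sum-cong-≗; sum-replicate-zero)

covering⇒≤ : ∀ {m n} (f : Fin m → Fin n) → (∀ j → ∃ λ i → f i ≡ j) → n ≤ m
covering⇒≤ f cover = injective⇒≤ {f = proj₁ ∘ cover} λ {j} {j′} e →
  trans (sym (proj₂ (cover j))) (trans (cong f e) (proj₂ (cover j′)))

∃-missing : ∀ {k} (f : Fin k → Fin (suc k)) → ∃ λ v → ∀ i → f i ≢ v
∃-missing {k} f with any? (λ v → all? (λ i → ¬? (f i ≟ v)))
... | yes missing = missing
... | no ¬missing = contradiction (covering⇒≤ f cover) 1+n≰n
  where
  cover : ∀ v → ∃ λ i → f i ≡ v
  cover v with i , ¬f≢v ← ¬∀⟶∃¬ k _ (λ i → ¬? (f i ≟ v)) (¬missing ∘ (v ,_))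
    = i , decidable-stable (f i ≟ v) ¬f≢v

injective⇒surjective : ∀ {n} {f : Fin n → Fin n} → Injective _≡_ _≡_ f → ∀ j → ∃ λ i → f i ≡ j
injective⇒surjective {suc n} {f} inj j with any? (λ i → f i ≟ j)
... | yes hit = hit
... | no miss =
  contradiction (injective⇒≤ {f = punchOut ∘ j≢f} (inj ∘ punchOut-injective (j≢f _) (j≢f _))) 1+n≰n
  where
  j≢f : ∀ i → j ≢ f i
  j≢f i e = miss (i , sym e)

∷-injective : ∀ {k} {f : Fin k → Fin (suc k)} {v} → Injective _≡_ _≡_ f → (∀ i → f i ≢ v) →
              Injective _≡_ _≡_ (v ∷ f)
∷-injective inj miss {zero}  {zero}  e = refl
∷-injective inj miss {zero}  {suc j} e = contradiction (sym e) (miss j)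
∷-injective inj miss {suc i} {zero}  e = contradiction e (miss i)
∷-injective inj miss {suc i} {suc j} e = cong suc (inj e)

sum-missing : ∀ {k} (w : Fin (suc k) → ℕ) {f : Fin k → Fin (suc k)} {v} →
              Injective _≡_ _≡_ f → (∀ i → f i ≢ v) → w v + sum (w ∘ f) ≡ sum w
sum-missing w {f} {v} inj miss = sym (sum-permute w (permutation g g⁻¹ g∘g⁻¹ g⁻¹∘g))
  where
  g = v ∷ f
  g-inj = ∷-injective inj miss
  g⁻¹ = λ j → proj₁ (injective⇒surjective g-inj j)
  g∘g⁻¹ : ∀ j → g (g⁻¹ j) ≡ j
  g∘g⁻¹ j = proj₂ (injective⇒surjective g-inj j)
  g⁻¹∘g : ∀ i → g⁻¹ (g i) ≡ i
  g⁻¹∘g i = g-inj (g∘g⁻¹ (g i))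

sum-suc : ∀ {n} (f : Fin n → ℕ) → sum (suc ∘ f) ≡ n + sum f
sum-suc {zero}  f = refl
sum-suc {suc n} f = cong suc (begin
  f zero + sum (suc ∘ f ∘ suc) ≡⟨ cong (f zero +_) (sum-suc (f ∘ suc)) ⟩
  f zero + (n + sum (f ∘ suc)) ≡⟨ x∙yz≈y∙xz (f zero) n _ ⟩
  n + (f zero + sum (f ∘ suc)) ∎)
  where open ≡-Reasoning

2*∑toℕ+n≡n*n : ∀ n → 2 * sum (toℕ {n}) + n ≡ n * n
2*∑toℕ+n≡n*n zero    = refl
2*∑toℕ+n≡n*n (suc n) = begin
  2 * sum (suc ∘ toℕ {n}) + suc n ≡⟨ cong (λ s → 2 * s + suc n) (sum-suc (toℕ {n})) ⟩
  2 * (n + S) + suc n             ≡⟨ regroup n S ⟩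
  (2 * S + n) + suc (2 * n)       ≡⟨ cong (_+ suc (2 * n)) (2*∑toℕ+n≡n*n n) ⟩
  n * n + suc (2 * n)             ≡⟨ square-suc n ⟩
  suc n * suc n                   ∎
  where
  open ≡-Reasoning
  S = sum (toℕ {n})
  regroup : ∀ n S → 2 * (n + S) + suc n ≡ (2 * S + n) + suc (2 * n)
  regroup = solve-∀
  square-suc : ∀ n → n * n + suc (2 * n) ≡ suc n * suc n
  square-suc = solve-∀

∑toℕ-odd : ∀ m → sum (toℕ {suc (2 * m)}) ≡ m * suc (2 * m)
∑toℕ-odd m = +-cancelʳ-≡ _ _ _ (*-cancelˡ-≡ _ _ 2 (begin
  2 * (sum (toℕ {N}) + N)     ≡⟨ distrib (sum (toℕ {N})) N ⟩
  (2 * sum (toℕ {N}) + N) + N ≡⟨ cong (_+ N) (2*∑toℕ+n≡n*n N) ⟩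
  N * N + N                   ≡⟨ odd-square m ⟩
  2 * (m * N + N)             ∎))
  where
  open ≡-Reasoning
  N = suc (2 * m)
  distrib : ∀ S N → 2 * (S + N) ≡ (2 * S + N) + N
  distrib = solve-∀
  odd-square : ∀ m → suc (2 * m) * suc (2 * m) + suc (2 * m) ≡
                     2 * (m * suc (2 * m) + suc (2 * m))
  odd-square = solve-∀

diagonal antidiagonal : (n : ℕ) .{{_ : NonZero n}} → Field n → Fin n
diagonal     n (x , y) = (toℕ x + toℕ y) mod n
antidiagonal n (x , y) = (toℕ x + (n ∸ toℕ y)) mod n

module _ {n : ℕ} .{{_ : NonZero n}} where

  toℕ-diagonal : ∀ p → toℕ (diagonal n p) ≡ sumMod n (proj₁ p) (proj₂ p)
  toℕ-diagonal (x , y) = toℕ-fromℕ< (m%n<n (toℕ x + toℕ y) n)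

  toℕ-antidiagonal : ∀ p → toℕ (antidiagonal n p) ≡ diffMod n (proj₁ p) (proj₂ p)
  toℕ-antidiagonal (x , y) = toℕ-fromℕ< (m%n<n (toℕ x + (n ∸ toℕ y)) n)

  diagonal-conflict : ∀ {a b} → diagonal n a ≡ diagonal n b → Conflict n a b
  diagonal-conflict {a} {b} e =
    inj₂ (inj₂ (inj₁ (trans (sym (toℕ-diagonal a)) (trans (cong toℕ e) (toℕ-diagonal b)))))

  antidiagonal-conflict : ∀ {a b} → antidiagonal n a ≡ antidiagonal n b → Conflict n a b
  antidiagonal-conflict {a} {b} e =
    inj₂ (inj₂ (inj₂ (trans (sym (toℕ-antidiagonal a)) (trans (cong toℕ e) (toℕ-antidiagonal b)))))

  conflict-sym : ∀ {a b} → Conflict n a b → Conflict n b a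
  conflict-sym (inj₁ e)                = inj₁ (sym e)
  conflict-sym (inj₂ (inj₁ e))         = inj₂ (inj₁ (sym e))
  conflict-sym (inj₂ (inj₂ (inj₁ e)))  = inj₂ (inj₂ (inj₁ (sym e)))
  conflict-sym (inj₂ (inj₂ (inj₂ e)))  = inj₂ (inj₂ (inj₂ (sym e)))

  NonAttacking⇒injective : ∀ {k} {q : Fin k → Field n} {A : Set} (line : Field n → A) →
                           (∀ {a b} → line a ≡ line b → Conflict n a b) →
                           NonAttacking n q → Injective _≡_ _≡_ (line ∘ q)
  NonAttacking⇒injective line conflict na {i} {j} e with i ≟ j
  ... | yes i≡j = i≡j
  ... | no  i≢j = contradiction (conflict e) (proj₂ (na i j i≢j))

  ∷-NonAttacking : ∀ {k} {q : Fin k → Field n} {p} → NonAttacking n q →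
                   (∀ j → ¬ Conflict n p (q j)) → NonAttacking n (p ∷ q)
  ∷-NonAttacking na safe zero    zero    0≢0 = contradiction refl 0≢0
  ∷-NonAttacking na safe zero    (suc j) _   = (λ e → safe j (inj₁ (cong proj₁ e))) , safe j
  ∷-NonAttacking na safe (suc i) zero    _   =
    (λ e → safe i (inj₁ (cong proj₁ (sym e)))) , safe i ∘ conflict-sym
  ∷-NonAttacking na safe (suc i) (suc j) i≢j = na i j (i≢j ∘ cong suc)

module Modulo (n : ℕ) where

  N : ℕ
  N = suc n

  infix 4 _≡ₘ_
  record _≡ₘ_ (a b : ℕ) : Set where
    constructor mod-≡
    field %-≡ : a % N ≡ b % N
  open _≡ₘ_ public

  ≡ₘ-isEquivalence : IsEquivalence _≡ₘ_
  ≡ₘ-isEquivalence = record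
    { refl  = mod-≡ refl
    ; sym   = λ a≡b → mod-≡ (sym (%-≡ a≡b))
    ; trans = λ a≡b b≡c → mod-≡ (trans (%-≡ a≡b) (%-≡ b≡c))
    }

  ≡ₘ-setoid : Setoid _ _
  ≡ₘ-setoid = record { isEquivalence = ≡ₘ-isEquivalence }

  open Setoid ≡ₘ-setoid public using () renaming (refl to ≡ₘ-refl; reflexive to ≡⇒≡ₘ; trans to ≡ₘ-trans)

  %-≡ₘ : ∀ a → a % N ≡ₘ a
  %-≡ₘ a = mod-≡ (m%n%n≡m%n a N)

  *N≡ₘ0 : ∀ a → a * N ≡ₘ 0
  *N≡ₘ0 a = mod-≡ (m*n%n≡0 a N)

  N≡ₘ0 : N ≡ₘ 0
  N≡ₘ0 = mod-≡ (n%n≡0 N)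

  ∸+≡ₘ0 : ∀ {a} → a ≤ N → N ∸ a + a ≡ₘ 0
  ∸+≡ₘ0 a≤N = ≡ₘ-trans (≡⇒≡ₘ (m∸n+n≡m a≤N)) N≡ₘ0

  +-congₘ : ∀ {a b c d} → a ≡ₘ b → c ≡ₘ d → a + c ≡ₘ b + d
  +-congₘ {a} {b} {c} {d} (mod-≡ a≡b) (mod-≡ c≡d) = mod-≡ (begin
    (a + c) % N             ≡⟨ %-distribˡ-+ a c N ⟩
    (a % N + c % N) % N     ≡⟨ cong₂ (λ x y → (x + y) % N) a≡b c≡d ⟩
    (b % N + d % N) % N     ≡⟨ %-distribˡ-+ b d N ⟨
    (b + d) % N             ∎)
    where open ≡-Reasoning

  +-cancelʳₘ : ∀ {a b} x → a + x ≡ₘ b + x → a ≡ₘ b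
  +-cancelʳₘ {a} {b} x a+x≡b+x = begin
    a                 ≡⟨ +-identityʳ a ⟨
    a + 0             ≈⟨ +-congₘ ≡ₘ-refl x+x̄≡ₘ0 ⟨
    a + (x + x̄)       ≡⟨ +-assoc a x x̄ ⟨
    a + x + x̄         ≈⟨ +-congₘ a+x≡b+x ≡ₘ-refl ⟩
    b + x + x̄         ≡⟨ +-assoc b x x̄ ⟩
    b + (x + x̄)       ≈⟨ +-congₘ ≡ₘ-refl x+x̄≡ₘ0 ⟩
    b + 0             ≡⟨ +-identityʳ b ⟩
    b                 ∎
    where
    open import Relation.Binary.Reasoning.Setoid ≡ₘ-setoid
    x̄ = N ∸ x % N
    x+x̄≡ₘ0 : x + x̄ ≡ₘ 0
    x+x̄≡ₘ0 = begin
      x + x̄         ≈⟨ +-congₘ (%-≡ₘ x) ≡ₘ-refl ⟨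
      x % N + x̄     ≡⟨ m+[n∸m]≡n (<⇒≤ (m%n<n x N)) ⟩
      N             ≈⟨ N≡ₘ0 ⟩
      0             ∎

  sum-congₘ : ∀ {k} {a b : Fin k → ℕ} → (∀ i → a i ≡ₘ b i) → sum a ≡ₘ sum b
  sum-congₘ {zero}  a≡b = ≡ₘ-refl
  sum-congₘ {suc k} a≡b = +-congₘ (a≡b zero) (sum-congₘ (a≡b ∘ suc))

  sum-zeroₘ : ∀ {k} {a : Fin k → ℕ} → (∀ i → a i ≡ₘ 0) → sum a ≡ₘ 0
  sum-zeroₘ {k} a≡0 = ≡ₘ-trans (sum-congₘ a≡0) (≡⇒≡ₘ (sum-replicate-zero k))

  sum-%ₘ : ∀ {k} (a b : Fin k → ℕ) → sum (λ i → (a i + b i) % N) ≡ₘ sum a + sum b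
  sum-%ₘ a b = ≡ₘ-trans (sum-congₘ (λ i → %-≡ₘ (a i + b i))) (≡⇒≡ₘ (∑-distrib-+ a b))

  <⇒≡% : ∀ {a} b → a < N → a ≡ₘ b → a ≡ b % N
  <⇒≡% b a<N (mod-≡ a≡b) = trans (sym (m<n⇒m%n≡m a<N)) a≡b

  inverse-additiveₘ : ∀ {a b c A B C} → a + A ≡ₘ 0 → b + B ≡ₘ 0 → c + C ≡ₘ 0 → C ≡ₘ A + B →
                     c ≡ₘ a + b
  inverse-additiveₘ {a} {b} {c} {A} {B} {C} a+A≡0 b+B≡0 c+C≡0 C≡A+B = +-cancelʳₘ (A + B) (begin
    c + (A + B)       ≈⟨ +-congₘ ≡ₘ-refl C≡A+B ⟨
    c + C             ≈⟨ c+C≡0 ⟩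
    0 + 0             ≈⟨ +-congₘ a+A≡0 b+B≡0 ⟨
    a + A + (b + B)   ≡⟨ interchange a A b B ⟩
    a + b + (A + B)   ∎)
    where open import Relation.Binary.Reasoning.Setoid ≡ₘ-setoid

  complement-inverseₘ : ∀ {k b} {y : Fin k → ℕ} → b ≤ N → (∀ i → y i ≤ N) →
                       b + sum y ≡ₘ 0 → N ∸ b + sum (λ i → N ∸ y i) ≡ₘ 0
  complement-inverseₘ {k} {b} {y} b≤N y≤N b+Σy≡0 = begin
    b̄ + Σȳ                      ≡⟨ +-identityʳ _ ⟨
    b̄ + Σȳ + 0                  ≈⟨ +-congₘ ≡ₘ-refl b+Σy≡0 ⟨
    b̄ + Σȳ + (b + sum y)        ≡⟨ interchange b̄ Σȳ b (sum y) ⟩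
    b̄ + b + (Σȳ + sum y)        ≡⟨ cong (b̄ + b +_) (∑-distrib-+ ȳ y) ⟨
    b̄ + b + sum (λ i → ȳ i + y i) ≈⟨ +-congₘ (∸+≡ₘ0 b≤N) (sum-zeroₘ (∸+≡ₘ0 ∘ y≤N)) ⟩
    0                           ∎
    where
    open import Relation.Binary.Reasoning.Setoid ≡ₘ-setoid
    b̄ = N ∸ b
    ȳ = λ i → N ∸ y i
    Σȳ = sum ȳ

  module _ {k} (q : Fin k → Field N) where

    sum-diagonalₘ : sum (toℕ ∘ diagonal N ∘ q) ≡ₘ sum (toℕ ∘ proj₁ ∘ q) + sum (toℕ ∘ proj₂ ∘ q)
    sum-diagonalₘ = ≡ₘ-trans (≡⇒≡ₘ (sum-cong-≗ (toℕ-diagonal ∘ q)))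
                             (sum-%ₘ (toℕ ∘ proj₁ ∘ q) (toℕ ∘ proj₂ ∘ q))

    sum-antidiagonalₘ : sum (toℕ ∘ antidiagonal N ∘ q) ≡ₘ
                        sum (toℕ ∘ proj₁ ∘ q) + sum (λ i → N ∸ toℕ (proj₂ (q i)))
    sum-antidiagonalₘ = ≡ₘ-trans (≡⇒≡ₘ (sum-cong-≗ (toℕ-antidiagonal ∘ q)))
                                 (sum-%ₘ (toℕ ∘ proj₁ ∘ q) (λ i → N ∸ toℕ (proj₂ (q i))))

  record MissingValue {k} (f : Fin k → Fin N) : Set where
    field
      value    : Fin N
      missing  : ∀ i → f i ≢ value
      balanced : toℕ value + sum (toℕ ∘ f) ≡ₘ 0

odd⇒MissingValue : ∀ m (f : Fin (2 * m) → Fin (suc (2 * m))) → Injective _≡_ _≡_ f →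
                   Modulo.MissingValue (2 * m) f
odd⇒MissingValue m f inj = record
  { value    = v
  ; missing  = v-missing
  ; balanced = ≡ₘ-trans (≡⇒≡ₘ (trans (sum-missing toℕ inj v-missing) (∑toℕ-odd m))) (*N≡ₘ0 m)
  }
  where
  open Modulo (2 * m)
  v = proj₁ (∃-missing f)
  v-missing = proj₂ (∃-missing f)

lemma4 : (m : ℕ) → (q : Fin (suc (2 * m) ∸ 1) → Field (suc (2 * m)))
       → NonAttacking (suc (2 * m)) q
       → ∃ λ (p : Field (suc (2 * m))) → NonAttacking (suc (2 * m)) (p ∷ q)
lemma4 m q na = (R.value , C.value) , ∷-NonAttacking na safe
  where
  open Modulo (2 * m)
  missing-line : ∀ line → (∀ {a b} → line a ≡ line b → Conflict N a b) → MissingValue (line ∘ q)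
  missing-line line conflict = odd⇒MissingValue m (line ∘ q) (NonAttacking⇒injective line conflict na)
  module R = MissingValue (missing-line proj₁ inj₁)
  module C = MissingValue (missing-line proj₂ (inj₂ ∘ inj₁))
  module S = MissingValue (missing-line (diagonal N) diagonal-conflict)
  module D = MissingValue (missing-line (antidiagonal N) antidiagonal-conflict)

  Σx Σy Σȳ : ℕ
  Σx = sum (toℕ ∘ proj₁ ∘ q)
  Σy = sum (toℕ ∘ proj₂ ∘ q)
  Σȳ = sum (λ i → N ∸ toℕ (proj₂ (q i)))

  s≡r+c : toℕ S.value ≡ sumMod N R.value C.value
  s≡r+c = <⇒≡% (toℕ R.value + toℕ C.value) (toℕ<n S.value)
    (inverse-additiveₘ {A = Σx} {B = Σy} R.balanced C.balanced S.balanced (sum-diagonalₘ q))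

  d≡r-c : toℕ D.value ≡ diffMod N R.value C.value
  d≡r-c = <⇒≡% (toℕ R.value + (N ∸ toℕ C.value)) (toℕ<n D.value)
    (inverse-additiveₘ {A = Σx} {B = Σȳ} R.balanced
      (complement-inverseₘ (<⇒≤ (toℕ<n C.value)) (λ i → <⇒≤ (toℕ<n (proj₂ (q i)))) C.balanced)
      D.balanced (sum-antidiagonalₘ q))

  safe : ∀ j → ¬ Conflict N (R.value , C.value) (q j)
  safe j (inj₁ e)               = R.missing j (sym e)
  safe j (inj₂ (inj₁ e))        = C.missing j (sym e)
  safe j (inj₂ (inj₂ (inj₁ e))) =
    S.missing j (toℕ-injective (trans (toℕ-diagonal (q j)) (sym (trans s≡r+c e))))
  safe j (inj₂ (inj₂ (inj₂ e))) =
    D.missing j (toℕ-injective (trans (toℕ-antidiagonal (q j)) (sym (trans d≡r-c e))))
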